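{- Let $G$ be a connected graph of order $n\geq 3$ containing at least one bridge. For a vertex $v$ of $G$, let $b(v)$ be the number of bridges of $G$ incident with $v$, and let $b=\max\{b(v): v\in V(G)\}$. Then $px_k(G)\geq b$ for each integer $k$ with $3\leq k\leq n$.
   Context: All graphs are finite, simple, undirected and connected. A bridge is an edge whose deletion disconnects the graph. An edge-coloring of a graph $G$ assigns colors to edges (adjacent edges may receive the same color). A tree in an edge-colored graph is a proper tree if any two adjacent edges of it receive different colors. For $S\subseteq V(G)$, an $S$-tree is a tree in $G$ containing all vertices of $S$. For a graph $G$ of order $n$ and an integer $k$ with $2\leq k\leq n$, an edge-coloring of $G$ is a $k$-proper coloring if for every set $S$ of $k$ vertices of $G$ there is a proper $S$-tree in $G$. The $k$-proper index $px_k(G)$ of a nontrivial connected graph $G$ is the smallest number of colors in a $k$-proper coloring of $G$. -}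

module Defs where

open import Data.Nat using (ℕ; _≤_; _<_)
open import Data.Fin using (Fin)
open import Data.Fin.Subset using (Subset; _∈_; _⊆_; ∣_∣)
open import Data.Bool using (Bool; true; false; _∧_; not)
open import Data.Product using (Σ; _×_; ∃)
open import Data.List using (List; length; lookup)
open import Data.List.Relation.Unary.Unique.Propositional using (Unique)
open import Relation.Binary.PropositionalEquality using (_≡_; _≢_)
open import Relation.Binary.Construct.Closure.ReflexiveTransitive using (Star)
open import Relation.Nullary using (¬_)
open import Level using (0ℓ)

record Graph (n : ℕ) : Set where
  field
    adj   : Fin n → Fin n → Bool
    sym   : ∀ u v → adj u v ≡ adj v u
    irrefl : ∀ v → adj v v ≡ false
open Graph public

Adj : ∀ {n} → Graph n → Fin n → Fin n → Set
Adj G u v = adj G u v ≡ true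

Connected : ∀ {n} → Graph n → Set
Connected G = ∀ u v → Star (Adj G) u v

DelAdj : ∀ {n} → Graph n → Fin n → Fin n → Fin n → Fin n → Set
DelAdj G a b u v = Adj G u v × ¬ ((u ≡ a × v ≡ b) Data.Sum.⊎ (u ≡ b × v ≡ a))
  where import Data.Sum

Bridge : ∀ {n} → Graph n → Fin n → Fin n → Set
Bridge G a b = Adj G a b × ¬ (∀ u v → Star (DelAdj G a b) u v)

-- An edge-colouring of G with m colours (adjacent edges may share colours);
-- the colour of the edge uv is col u v, required symmetric on edges.
record Coloring {n} (G : Graph n) (m : ℕ) : Set where
  field
    col    : Fin n → Fin n → Fin m
    colSym : ∀ u v → Adj G u v → col u v ≡ col v u
open Coloring public

HasCycle : ∀ {n} → (Fin n → Fin n → Set) → Set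
HasCycle {n} E =
  Σ (List (Fin n)) λ cyc →
    (3 ≤ length cyc) × Unique cyc ×
    (∀ (i : Fin (length cyc)) (j : Fin (length cyc)) →
       (Data.Fin.toℕ j ≡ Data.Nat.suc (Data.Fin.toℕ i)) ⊎
       (Data.Nat.suc (Data.Fin.toℕ i) ≡ length cyc × Data.Fin.toℕ j ≡ 0) →
       E (lookup cyc i) (lookup cyc j))
  where open import Data.Sum using (_⊎_)
        import Data.Nat
        import Data.Fin

record Tree {n} (G : Graph n) : Set₁ where
  field
    W        : Subset n
    E        : Fin n → Fin n → Set
    E-sym    : ∀ u v → E u v → E v u
    E-sub    : ∀ u v → E u v → Adj G u v
    E-in     : ∀ u v → E u v → u ∈ W
    conn     : ∀ u v → u ∈ W → v ∈ W → Star E u v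
    acyclic  : ¬ HasCycle E
open Tree public

ProperTree : ∀ {n} {G : Graph n} {m} → Coloring G m → Tree G → Set
ProperTree c T = ∀ u v w → E T u v → E T u w → v ≢ w → col c u v ≢ col c u w

KProper : ∀ {n} {G : Graph n} {m} → ℕ → Coloring G m → Set₁
KProper {n} {G} k c =
  ∀ (S : Subset n) → ∣ S ∣ ≡ k →
    Σ (Tree G) λ T → (S ⊆ W T) × ProperTree c T

-- In a connected graph, an edge vw is a bridge exactly when every walk from w to v passes
-- through vw. Let x ≠ y be bridge-neighbours of v. Any tree containing x and y contains an
-- x–y walk, which (continued along yv) passes through vx, and symmetrically through vy;
-- so a proper tree spanning a k-set S ⊇ {x, y} (possible as soon as 2 ≤ k ≤ n) gives vx and
-- vy distinct colours. The colouring restricted to the edges at v is thus injective on the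
-- bridge-neighbours, and there are at most m colours.
module Submission where

open import Defs
open import Data.Nat using (ℕ; _≤_)
open import Data.Fin using (Fin)
open import Data.Fin.Subset using (Subset; _∈_; ∣_∣)
open import Data.Product using (Σ; _×_; ∃)
open import Function.Bundles using (_⇔_)

open import Data.Nat using (zero; suc; _+_; z≤n; s≤s; _≤?_)
open import Data.Nat.Properties
  using (≤-trans; n≤1+n; ≤-antisym; ≰⇒>; +-suc; +-monoʳ-≤; module ≤-Reasoning)
open import Data.Fin using (zero; suc; _≟_)
open import Data.Fin.Properties using (suc-injective; injective⇒≤)
open import Data.Fin.Subset using (_⊆_; _∪_; ⊤; ⁅_⁆; inside; outside)
open import Data.Fin.Subset.Properties
  using (s⊆s; ⊆⊤; ∣⊤∣≡n; ∣⁅x⁆∣≡1; x∈⁅x⁆; p⊆p∪q; q⊆p∪q)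
open import Data.Vec using ([]; _∷_; here; there)
open import Data.Product using (_,_; proj₁)
open import Data.Sum using (_⊎_; inj₁; inj₂)
open import Data.Empty using (⊥-elim)
open import Function using (_∘_)
open import Function.Definitions using (Injective)
open import Function.Bundles using (module Equivalence)
open import Relation.Nullary using (¬_; Dec; yes; no)
open import Relation.Nullary.Decidable using (_×-dec_; _⊎-dec_; decidable-stable)
open import Relation.Binary.PropositionalEquality
  using (_≡_; _≢_; refl; trans; cong; subst)
import Relation.Binary.PropositionalEquality as ≡
open import Relation.Binary.Construct.Closure.ReflexiveTransitive
  using (Star; ε; _◅_; _◅◅_; _⋆; reverse)

private
  variable
    n m : ℕ

∣p∪q∣≤∣p∣+∣q∣ : (p q : Subset n) → ∣ p ∪ q ∣ ≤ ∣ p ∣ + ∣ q ∣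
∣p∪q∣≤∣p∣+∣q∣ []            []            = z≤n
∣p∪q∣≤∣p∣+∣q∣ (outside ∷ p) (outside ∷ q) = ∣p∪q∣≤∣p∣+∣q∣ p q
∣p∪q∣≤∣p∣+∣q∣ (inside  ∷ p) (outside ∷ q) = s≤s (∣p∪q∣≤∣p∣+∣q∣ p q)
∣p∪q∣≤∣p∣+∣q∣ (outside ∷ p) (inside  ∷ q) =
  subst (suc ∣ p ∪ q ∣ ≤_) (≡.sym (+-suc ∣ p ∣ ∣ q ∣)) (s≤s (∣p∪q∣≤∣p∣+∣q∣ p q))
∣p∪q∣≤∣p∣+∣q∣ (inside  ∷ p) (inside  ∷ q) =
  s≤s (≤-trans (∣p∪q∣≤∣p∣+∣q∣ p q) (+-monoʳ-≤ ∣ p ∣ (n≤1+n ∣ q ∣)))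

∣⁅x⁆∪⁅y⁆∣≤2 : (x y : Fin n) → ∣ ⁅ x ⁆ ∪ ⁅ y ⁆ ∣ ≤ 2
∣⁅x⁆∪⁅y⁆∣≤2 x y = begin
  ∣ ⁅ x ⁆ ∪ ⁅ y ⁆ ∣     ≤⟨ ∣p∪q∣≤∣p∣+∣q∣ ⁅ x ⁆ ⁅ y ⁆ ⟩
  ∣ ⁅ x ⁆ ∣ + ∣ ⁅ y ⁆ ∣ ≡⟨ ≡.cong₂ _+_ (∣⁅x⁆∣≡1 x) (∣⁅x⁆∣≡1 y) ⟩
  2                     ∎
  where open ≤-Reasoning

superset-of-size : ∀ {k} (p : Subset n) → ∣ p ∣ ≤ k → k ≤ n →
                   ∃ λ q → p ⊆ q × ∣ q ∣ ≡ k
superset-of-size {k = zero}  []            _         _  = [] , (λ x → x) , refl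
superset-of-size {k = suc k} (inside ∷ p)  (s≤s p≤k) (s≤s k≤n)
  with q , p⊆q , ∣q∣≡k ← superset-of-size p p≤k k≤n = inside ∷ q , s⊆s p⊆q , cong suc ∣q∣≡k
superset-of-size {n = suc n} {k} (outside ∷ p) p≤k k≤1+n with k ≤? n
... | yes k≤n with q , p⊆q , ∣q∣≡k ← superset-of-size p p≤k k≤n = outside ∷ q , s⊆s p⊆q , ∣q∣≡k
... | no  k≰n = ⊤ , ⊆⊤ , trans (∣⊤∣≡n (suc n)) (≤-antisym (≰⇒> k≰n) k≤1+n)

enumerate : (p : Subset n) → Fin ∣ p ∣ → Fin n
enumerate (outside ∷ p) i       = suc (enumerate p i)
enumerate (inside  ∷ p) zero    = zero
enumerate (inside  ∷ p) (suc i) = suc (enumerate p i)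

enumerate-∈ : (p : Subset n) (i : Fin ∣ p ∣) → enumerate p i ∈ p
enumerate-∈ (outside ∷ p) i       = there (enumerate-∈ p i)
enumerate-∈ (inside  ∷ p) zero    = here
enumerate-∈ (inside  ∷ p) (suc i) = there (enumerate-∈ p i)

enumerate-injective : (p : Subset n) → Injective _≡_ _≡_ (enumerate p)
enumerate-injective (outside ∷ p) eq = enumerate-injective p (suc-injective eq)
enumerate-injective (inside  ∷ p) {zero}  {zero}  _  = refl
enumerate-injective (inside  ∷ p) {suc i} {suc j} eq =
  cong suc (enumerate-injective p (suc-injective eq))

injectiveOn⇒∣p∣≤m : (p : Subset n) (f : Fin n → Fin m) →
                    (∀ {x y} → x ∈ p → y ∈ p → f x ≡ f y → x ≡ y) → ∣ p ∣ ≤ m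
injectiveOn⇒∣p∣≤m p f f-inj = injective⇒≤ λ {i} {j} eq →
  enumerate-injective p (f-inj (enumerate-∈ p i) (enumerate-∈ p j) eq)

≡-edge? : (a b u v : Fin n) → Dec ((u ≡ a × v ≡ b) ⊎ (u ≡ b × v ≡ a))
≡-edge? a b u v = ((u ≟ a) ×-dec (v ≟ b)) ⊎-dec ((u ≟ b) ×-dec (v ≟ a))

module _ (G : Graph n) where

  Adj⇒≢ : ∀ {u v} → Adj G u v → u ≢ v
  Adj⇒≢ {v = v} uv refl with trans (≡.sym uv) (irrefl G v)
  ... | ()

  DelAdj-sym : ∀ a b {u v} → DelAdj G a b u v → DelAdj G a b v u
  DelAdj-sym a b {u} {v} (uv , uv≢ab) = trans (Graph.sym G v u) uv , λ
    { (inj₁ (v≡a , u≡b)) → uv≢ab (inj₂ (u≡b , v≡a))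
    ; (inj₂ (v≡b , u≡a)) → uv≢ab (inj₁ (u≡a , v≡b)) }

  bridge-separates : Connected G → ∀ {a b} → Bridge G a b → ¬ Star (DelAdj G a b) a b
  bridge-separates G-conn {a} {b} (_ , ¬conn) a⇝b = ¬conn λ u v → (detour ⋆) (G-conn u v)
    where
    detour : ∀ {u v} → Adj G u v → Star (DelAdj G a b) u v
    detour {u} {v} uv with ≡-edge? a b u v
    ... | yes (inj₁ (refl , refl)) = a⇝b
    ... | yes (inj₂ (refl , refl)) = reverse (DelAdj-sym a b) a⇝b
    ... | no  uv≢ab                = (uv , uv≢ab) ◅ ε

  module _ {E : Fin n → Fin n → Set} (E⊆Adj : ∀ {u v} → E u v → Adj G u v) where

    walk-crosses-or-avoids : ∀ a b {u v} → Star E u v →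
                             (E a b ⊎ E b a) ⊎ Star (DelAdj G a b) u v
    walk-crosses-or-avoids a b ε = inj₂ ε
    walk-crosses-or-avoids a b (_◅_ {u} {u′} uu′ walk) with ≡-edge? a b u u′
    ... | yes (inj₁ (refl , refl)) = inj₁ (inj₁ uu′)
    ... | yes (inj₂ (refl , refl)) = inj₁ (inj₂ uu′)
    ... | no  uu′≢ab with walk-crosses-or-avoids a b walk
    ...   | inj₁ crosses = inj₁ crosses
    ...   | inj₂ avoids  = inj₂ ((E⊆Adj uu′ , uu′≢ab) ◅ avoids)

    -- Continuing a walk from w to w′ by the edge w′v would join w to v in G − vw.
    walk-from-bridge-end-crosses : Connected G → ∀ {v w w′} → Bridge G v w → Adj G v w′ →
                                   w ≢ w′ → Star E w w′ → E v w ⊎ E w v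
    walk-from-bridge-end-crosses G-conn {v} {w} {w′} vw vw′ w≢w′ walk
      with walk-crosses-or-avoids v w walk
    ... | inj₁ crosses = crosses
    ... | inj₂ avoids  = ⊥-elim (bridge-separates G-conn vw
                           (reverse (DelAdj-sym v w) (avoids ◅◅ (w′v ◅ ε))))
      where
      w′v : DelAdj G v w w′ v
      w′v = trans (Graph.sym G w′ v) vw′ , λ
        { (inj₁ (_ , v≡w))  → Adj⇒≢ (proj₁ vw) v≡w
        ; (inj₂ (w′≡w , _)) → w≢w′ (≡.sym w′≡w) }

  tree-contains-bridge : Connected G → (T : Tree G) → ∀ {v w w′} → Bridge G v w →
                         Adj G v w′ → w ≢ w′ → w ∈ W T → w′ ∈ W T → E T v w
  tree-contains-bridge G-conn T vw vw′ w≢w′ w∈T w′∈T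
    with walk-from-bridge-end-crosses (E-sub T _ _) G-conn vw vw′ w≢w′ (conn T _ _ w∈T w′∈T)
  ... | inj₁ vw∈T = vw∈T
  ... | inj₂ wv∈T = E-sym T _ _ wv∈T

  bridges-at-vertex-coloured-apart :
    Connected G → ∀ {k m} {c : Coloring G m} → 2 ≤ k → k ≤ n → KProper k c →
    ∀ {v x y} → Bridge G v x → Bridge G v y → x ≢ y → col c v x ≢ col c v y
  bridges-at-vertex-coloured-apart G-conn {c = c} 2≤k k≤n c-proper {v} {x} {y} vx vy x≢y
    with superset-of-size (⁅ x ⁆ ∪ ⁅ y ⁆) (≤-trans (∣⁅x⁆∪⁅y⁆∣≤2 x y) 2≤k) k≤n
  ... | S , xy⊆S , ∣S∣≡k with c-proper S ∣S∣≡k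
  ...   | T , S⊆T , T-proper = T-proper v x y vx∈T vy∈T x≢y
    where
    x∈T : x ∈ W T
    x∈T = S⊆T (xy⊆S (p⊆p∪q ⁅ y ⁆ (x∈⁅x⁆ x)))
    y∈T : y ∈ W T
    y∈T = S⊆T (xy⊆S (q⊆p∪q ⁅ x ⁆ ⁅ y ⁆ (x∈⁅x⁆ y)))
    vx∈T : E T v x
    vx∈T = tree-contains-bridge G-conn T vx (proj₁ vy) x≢y x∈T y∈T
    vy∈T : E T v y
    vy∈T = tree-contains-bridge G-conn T vy (proj₁ vx) (x≢y ∘ ≡.sym) y∈T x∈T

lemma3p5 : (n : ℕ) → 3 ≤ n → (G : Graph n) → Connected G →
    (∃ λ a → ∃ λ b → Bridge G a b) →
    (k : ℕ) → 3 ≤ k → k ≤ n →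
    (m : ℕ) → (c : Coloring G m) → KProper k c →
    (v : Fin n) → (B : Subset n) → (∀ w → (w ∈ B) ⇔ Bridge G v w) →
    ∣ B ∣ ≤ m
lemma3p5 n _ G G-conn _ k 3≤k k≤n m c c-proper v B B⇔bridges =
  injectiveOn⇒∣p∣≤m B (col c v) λ {x} {y} x∈B y∈B vx≡vy →
    decidable-stable (x ≟ y) λ x≢y →
      bridges-at-vertex-coloured-apart G G-conn {c = c} (≤-trans (n≤1+n 2) 3≤k) k≤n c-proper
        (bridge x∈B) (bridge y∈B) x≢y vx≡vy
  where
  bridge : ∀ {w} → w ∈ B → Bridge G v w
  bridge {w} = Equivalence.to (B⇔bridges w)
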